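{- Let $G=(V,E)$ be a graph, let $H=(V,A)$ be an acyclic orientation of $G$, and let $P_>\subseteq V\times V$ be the transitive closure of $H$, i.e., $(u,v)\in P_>$ iff there is a directed path from $u$ to $v$ in $H$. Let $\mathrm{ALG}$ be a sequential algorithm. Then for every bijection $\sigma:\{1,\dots,n\}\to V$ that is a linear extension of $P_>$ (i.e., $\sigma^{ -1}(u)>\sigma^{ -1}(v)$ for every $(u,v)\in P_>$), the output of $\mathrm{ALG}(G,\sigma)$ is the same.
   Context: A sequential algorithm is specified by a function $f$ mapping finite sets of values to values. On input a graph $G=(V,E)$ with $n$ vertices and a bijection $\sigma:\{1,\dots,n\}\to V$, for $i=1,\dots,n$ it sets $g(\sigma(i))\gets f(\{g(v): v\text{ a neighbor of }\sigma(i),\ \sigma^{ -1}(v)<i\})$, and outputs $g$. An orientation of $G$ directs each edge in exactly one direction; it is acyclic if it has no directed cycle. -}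

module Defs where

open import Data.Nat using (ℕ; zero; suc; _≤_; _<_)
open import Data.Nat.Properties using (≤-trans; n≤1+n; ≤-refl)
open import Data.Fin using (Fin; zero; suc; inject≤; fromℕ<)
import Data.Fin as Fin
open import Data.List using (List; map; filter; allFin)
open import Data.List.Relation.Binary.BagAndSetEquality using (_∼[_]_; set)
open import Data.Product using (_×_)
open import Data.Sum using (_⊎_)
open import Data.Empty using (⊥)
open import Relation.Nullary using (¬_; Dec)
open import Relation.Binary.PropositionalEquality using (_≡_)
open import Relation.Binary.Construct.Closure.Transitive using (TransClosure)
open import Function using (_∘_)
open import Function.Bundles using (_↔_; Inverse)

record Graph (V : Set) : Set₁ where
  field
    Adj    : V → V → Set
    adj?   : ∀ u v → Dec (Adj u v)
    sym    : ∀ {u v} → Adj u v → Adj v u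
    irrefl : ∀ {v} → ¬ Adj v v
open Graph public

record IsOrientation {V : Set} (G : Graph V) (H : V → V → Set) : Set where
  field
    arc⇒edge : ∀ {u v} → H u v → Adj G u v
    edge⇒arc : ∀ {u v} → Adj G u v → H u v ⊎ H v u
    not-both : ∀ {u v} → H u v → H v u → ⊥
open IsOrientation public

Reach : {V : Set} → (V → V → Set) → V → V → Set
Reach H = TransClosure H

Acyclic : {V : Set} → (V → V → Set) → Set
Acyclic H = ∀ v → ¬ Reach H v v

-- A sequential algorithm: a function f from finite sets of values to values,
-- represented as a function on lists that only depends on the underlying set.
record SeqAlg (X : Set) : Set where
  field
    f       : List X → X
    set-inv : ∀ {xs ys} → xs ∼[ set ] ys → f xs ≡ f ys
open SeqAlg public

-- σ : {1..n} → V is a bijection; we use 0-based positions Fin n.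
-- Inverse.to σ = σ, Inverse.from σ = σ⁻¹.
module Run {V : Set} {X : Set} (G : Graph V) (ALG : SeqAlg X) {n : ℕ} (σ : Fin n ↔ V) where
  private
    σ→ : Fin n → V
    σ→ = Inverse.to σ

  snoc : ∀ {k} → (Fin k → X) → X → Fin (suc k) → X
  snoc {zero}  h x _       = x
  snoc {suc k} h x zero    = h zero
  snoc {suc k} h x (suc j) = snoc (h ∘ suc) x j

  -- prefix k p j = g(σ(j)) as computed after the first k steps (j < k)
  prefix : (k : ℕ) → k ≤ n → Fin k → X
  prefix zero    _ ()
  prefix (suc k) p =
    snoc h (f ALG (map h (filter (λ j → adj? G (σ→ (inject≤ j k≤n)) (σ→ (fromℕ< p))) (allFin k))))
    where
      k≤n : k ≤ n
      k≤n = ≤-trans (n≤1+n k) p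
      h : Fin k → X
      h = prefix k k≤n

  output : V → X
  output v = prefix n ≤-refl (Inverse.from σ v)

run : {V : Set} {X : Set} → Graph V → SeqAlg X → {n : ℕ} → Fin n ↔ V → V → X
run G ALG σ = Run.output G ALG σ

LinearExtension : {V : Set} {n : ℕ} → (V → V → Set) → Fin n ↔ V → Set
LinearExtension H σ = ∀ {u v} → Reach H u v → Inverse.from σ v Fin.< Inverse.from σ u

-- If σ is a linear extension of the reachability order of H, every neighbour u of v that σ
-- places before v is exactly an out-neighbour of v in H (an arc v → u).  Hence the value
-- g(v) computed by ALG(G, σ) is f applied to the set {g(u) : v → u in H}, a recursion that
-- mentions σ only through well-foundedness.  Two such runs therefore agree by well-founded
-- induction along the arcs of H.
module Submission where

open import Defs hiding (sym)
open import Data.Nat as ℕ using (ℕ; suc; _≤_; _≤′_; ≤′-refl; ≤′-step)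
open import Data.Nat.Properties using (≤-trans; n≤1+n; ≤-refl; ≤-irrelevant; ≤⇒≤′; ≤′⇒≤; <-irrefl; <-trans)
open import Data.Fin using (Fin; zero; suc; inject≤; inject₁; fromℕ; fromℕ<; toℕ; _<_)
open import Data.Fin.Properties using (toℕ-injective; toℕ<n; toℕ-fromℕ; toℕ-fromℕ<; fromℕ<-toℕ; toℕ-inject₁; toℕ-inject≤)
open import Data.Fin.Induction using (<-wellFounded)
open import Data.List using (List; map; filter; allFin)
open import Data.List.Membership.Propositional using (_∈_)
open import Data.List.Membership.Propositional.Properties using (∈-map⁺; ∈-map⁻; ∈-filter⁺; ∈-filter⁻; ∈-allFin)
open import Data.List.Relation.Binary.BagAndSetEquality using (_∼[_]_; set)
open import Data.Product using (_×_; _,_; ∃-syntax)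
open import Data.Sum using (inj₁; inj₂)
open import Data.Empty using (⊥-elim)
open import Function using (_∘_; flip)
open import Function.Bundles using (_↔_; _⇔_; Inverse; Equivalence; mk⇔)
open import Relation.Nullary using (Dec)
open import Relation.Binary.PropositionalEquality using (_≡_; refl; sym; trans; cong; subst; subst₂; module ≡-Reasoning)
open import Relation.Binary.Construct.Closure.Transitive using ([_])
open import Induction.WellFounded using (WellFounded; module Subrelation; module All)
import Relation.Binary.Construct.On as On

∈-map-filter-allFin⁻ : ∀ {k} {X : Set} {P : Fin k → Set} (P? : ∀ j → Dec (P j)) (h : Fin k → X) {x} →
                       x ∈ map h (filter P? (allFin k)) → ∃[ j ] P j × x ≡ h j
∈-map-filter-allFin⁻ P? h x∈ with ∈-map⁻ h x∈
... | j , j∈ , x≡hj with ∈-filter⁻ P? {xs = allFin _} j∈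
...   | _ , Pj = j , Pj , x≡hj

∈-map-filter-allFin⁺ : ∀ {k} {X : Set} {P : Fin k → Set} (P? : ∀ j → Dec (P j)) (h : Fin k → X) {j} →
                       P j → h j ∈ map h (filter P? (allFin k))
∈-map-filter-allFin⁺ P? h {j} Pj = ∈-map⁺ h (∈-filter⁺ P? (∈-allFin j) Pj)

module RunProperties {V X : Set} (G : Graph V) (ALG : SeqAlg X) {n : ℕ} (σ : Fin n ↔ V) where
  open Run G ALG σ
  open Inverse σ using (to; from; strictlyInverseˡ; strictlyInverseʳ)

  snoc-inject₁ : ∀ {k} (h : Fin k → X) x (j : Fin k) → snoc h x (inject₁ j) ≡ h j
  snoc-inject₁ {suc k} h x zero    = refl
  snoc-inject₁ {suc k} h x (suc j) = snoc-inject₁ (h ∘ suc) x j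

  snoc-fromℕ : ∀ {k} (h : Fin k → X) x → snoc h x (fromℕ k) ≡ x
  snoc-fromℕ {ℕ.zero} h x = refl
  snoc-fromℕ {suc k}  h x = snoc-fromℕ (h ∘ suc) x

  prefix-extend : ∀ {k m} → k ≤′ m → (k≤n : k ≤ n) (m≤n : m ≤ n) (j : Fin k) (k≤m : k ≤ m) →
                  prefix k k≤n j ≡ prefix m m≤n (inject≤ j k≤m)
  prefix-extend ≤′-refl k≤n m≤n j _
    rewrite ≤-irrelevant k≤n m≤n = cong (prefix _ m≤n) (toℕ-injective (sym (toℕ-inject≤ j _)))
  prefix-extend (≤′-step {m} k≤′m) k≤n m+1≤n j k≤m+1 = begin
    prefix _ k≤n j                                 ≡⟨ prefix-extend k≤′m k≤n m≤n j k≤m ⟩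
    prefix m m≤n (inject≤ j k≤m)                   ≡⟨ sym (snoc-inject₁ _ _ (inject≤ j k≤m)) ⟩
    prefix (suc m) m+1≤n (inject₁ (inject≤ j k≤m)) ≡⟨ cong (prefix (suc m) m+1≤n) inject-comm ⟩
    prefix (suc m) m+1≤n (inject≤ j k≤m+1)         ∎
    where
      open ≡-Reasoning
      m≤n = ≤-trans (n≤1+n m) m+1≤n
      k≤m = ≤′⇒≤ k≤′m
      inject-comm : inject₁ (inject≤ j k≤m) ≡ inject≤ j k≤m+1
      inject-comm = toℕ-injective (trans (toℕ-inject₁ _) (trans (toℕ-inject≤ j k≤m) (sym (toℕ-inject≤ j k≤m+1))))

  out : Fin n → X
  out = prefix n ≤-refl

  prefix-out : ∀ {k} (k≤n : k ≤ n) (j : Fin k) → prefix k k≤n j ≡ out (inject≤ j k≤n)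
  prefix-out k≤n j = prefix-extend (≤⇒≤′ k≤n) k≤n ≤-refl j k≤n

  inputs : Fin n → List X
  inputs i = map (prefix k k≤n) (filter (λ j → adj? G (to (inject≤ j k≤n)) (to (fromℕ< i<n))) (allFin k))
    where
      k = toℕ i
      i<n = toℕ<n i
      k≤n = ≤-trans (n≤1+n k) i<n

  out-unfold : ∀ i → out i ≡ f ALG (inputs i)
  out-unfold i = begin
    out i                                ≡⟨ cong out (sym i≡last) ⟩
    out (inject≤ (fromℕ (toℕ i)) i<n)    ≡⟨ sym (prefix-out i<n (fromℕ (toℕ i))) ⟩
    prefix (suc (toℕ i)) i<n (fromℕ _)   ≡⟨ snoc-fromℕ (prefix (toℕ i) (≤-trans (n≤1+n _) i<n)) _ ⟩
    f ALG (inputs i)                     ∎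
    where
      open ≡-Reasoning
      i<n = toℕ<n i
      i≡last : inject≤ (fromℕ (toℕ i)) i<n ≡ i
      i≡last = toℕ-injective (trans (toℕ-inject≤ _ i<n) (toℕ-fromℕ (toℕ i)))

  output-unfold : ∀ v → output v ≡ f ALG (inputs (from v))
  output-unfold v = out-unfold (from v)

  to-fromℕ<-toℕ : ∀ i → to (fromℕ< (toℕ<n i)) ≡ to i
  to-fromℕ<-toℕ i = cong to (fromℕ<-toℕ i (toℕ<n i))

  ∈-inputs⁻ : ∀ {i x} → x ∈ inputs i → ∃[ j ] j < i × Adj G (to j) (to i) × x ≡ out j
  ∈-inputs⁻ {i} x∈ with ∈-map-filter-allFin⁻ _ _ x∈
  ... | j , adj , x≡ =
    inject≤ j _ , subst (ℕ._< toℕ i) (sym (toℕ-inject≤ j _)) (toℕ<n j) ,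
    subst (Adj G _) (to-fromℕ<-toℕ i) adj , trans x≡ (prefix-out _ j)

  ∈-inputs⁺ : ∀ {i j} → j < i → Adj G (to j) (to i) → out j ∈ inputs i
  ∈-inputs⁺ {i} {j} j<i adj =
    subst (_∈ inputs i) (trans (prefix-out _ j′) (cong out j′≡j))
      (∈-map-filter-allFin⁺ _ _ (subst₂ (Adj G) (cong to (sym j′≡j)) (sym (to-fromℕ<-toℕ i)) adj))
    where
      j′ = fromℕ< j<i
      j′≡j : inject≤ j′ (≤-trans (n≤1+n _) (toℕ<n i)) ≡ j
      j′≡j = toℕ-injective (trans (toℕ-inject≤ j′ _) (toℕ-fromℕ< j<i))

  module _ (H : V → V → Set) (O : IsOrientation G H) (σ-ext : LinearExtension H σ) where

    arc-flip-wellFounded : WellFounded (flip H)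
    arc-flip-wellFounded = Subrelation.wellFounded (λ h → σ-ext [ h ]) (On.wellFounded from <-wellFounded)

    -- An earlier neighbour u of v cannot be the tail of an arc u → v, since then σ would place v first.
    ∈-inputs⇔arc : ∀ {v x} → x ∈ inputs (from v) ⇔ (∃[ u ] H v u × x ≡ output u)
    ∈-inputs⇔arc {v} = mk⇔ forward backward
      where
        forward : ∀ {x} → x ∈ inputs (from v) → ∃[ u ] H v u × x ≡ output u
        forward x∈ with ∈-inputs⁻ x∈
        ... | j , j<v , adj , x≡ with edge⇒arc O (subst (Adj G _) (strictlyInverseˡ v) adj)
        ...   | inj₁ arc-to-v = ⊥-elim (<-irrefl refl (<-trans j<v (subst (from v <_) (strictlyInverseʳ j) (σ-ext [ arc-to-v ]))))
        ...   | inj₂ arc-from-v = to j , arc-from-v , trans x≡ (cong out (sym (strictlyInverseʳ j)))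

        backward : ∀ {x} → ∃[ u ] H v u × x ≡ output u → x ∈ inputs (from v)
        backward (u , arc , refl) =
          ∈-inputs⁺ (σ-ext [ arc ])
            (subst₂ (Adj G) (sym (strictlyInverseˡ u)) (sym (strictlyInverseˡ v)) (Graph.sym G (arc⇒edge O arc)))

lemma11 : {V X : Set} (n : ℕ) (G : Graph V) (H : V → V → Set) →
    IsOrientation G H → Acyclic H → (ALG : SeqAlg X) →
    (σ τ : Fin n ↔ V) → LinearExtension H σ → LinearExtension H τ →
    ∀ v → run G ALG σ v ≡ run G ALG τ v
lemma11 n G H O _ ALG σ τ σ-ext τ-ext =
  All.wfRec (S.arc-flip-wellFounded H O σ-ext) _ (λ v → run G ALG σ v ≡ run G ALG τ v) step
  where
    module S = RunProperties G ALG σ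
    module T = RunProperties G ALG τ
    open ≡-Reasoning

    step : ∀ v → (∀ {u} → H v u → run G ALG σ u ≡ run G ALG τ u) → run G ALG σ v ≡ run G ALG τ v
    step v IH = begin
      run G ALG σ v                       ≡⟨ S.output-unfold v ⟩
      f ALG (S.inputs (Inverse.from σ v)) ≡⟨ set-inv ALG same-inputs ⟩
      f ALG (T.inputs (Inverse.from τ v)) ≡⟨ sym (T.output-unfold v) ⟩
      run G ALG τ v                       ∎
      where
        same-inputs : S.inputs (Inverse.from σ v) ∼[ set ] T.inputs (Inverse.from τ v)
        same-inputs = mk⇔
          (λ x∈ → let (u , arc , x≡) = Equivalence.to (S.∈-inputs⇔arc H O σ-ext) x∈ in
            Equivalence.from (T.∈-inputs⇔arc H O τ-ext) (u , arc , trans x≡ (IH arc)))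
          (λ x∈ → let (u , arc , x≡) = Equivalence.to (T.∈-inputs⇔arc H O τ-ext) x∈ in
            Equivalence.from (S.∈-inputs⇔arc H O σ-ext) (u , arc , trans x≡ (sym (IH arc))))
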